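{- Let $n\ge 12$ be even. There is no feasible, single-break, ranking-fair schedule for $n$ teams whose D-sequence is a cyclic rotation, or the reversal of a cyclic rotation, of $(2,2,\dots,2,1)$ (i.e., the canonical pattern set does not allow a ranking-fair schedule).
   Context: Teams are $T=\{1,\dots,n\}$ ($n$ even), ranked by strength: team $i$ is stronger than team $j$ iff $i<j$. Rounds are $R=\{1,\dots,n-1\}$. A schedule assigns to each unordered pair of distinct teams a round in $R$ and designates which of the two plays at home (the other away). It is feasible if every team plays exactly one game in every round. The ranking HAP of team $i$ is the vector $(p_1,\dots,p_{n-1})$, $p_m\in\{H,A\}$ indicating whether team $i$ plays home or away against its $m$-th strongest opponent (opponents in increasing order of index). A schedule is ranking-fair if every team's ranking HAP alternates between $H$ and $A$. The HAP of a team is $(h_1,\dots,h_{n-1})$ with $h_r$ its venue in round $r$, read cyclically ($h_0:=h_{n-1}$); a team has a break in round $r$ if $h_{r-1}=h_r$. A schedule is single-break if every team has exactly one break. In a feasible single-break schedule the breaks occur in exactly $n/2$ distinct rounds $r_1<\dots<r_{n/2}$ (two teams having a break in each); the D-sequence is $(d_1,\dots,d_{n/2})$ with $d_i=r_{i+1}-r_i$ and $r_{n/2+1}:=r_1+n-1$. The canonical pattern set is the HAP set of a single-break schedule with D-sequence $(2,\dots,2,1)$ (up to cyclic rotation and reversal), e.g. breaks in rounds $1,2,4,6,\dots,n-2$. -}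

module Defs where

open import Data.Nat using (ℕ; zero; suc; _+_; _∸_; _<_; _<ᵇ_; _≡ᵇ_)
open import Data.Bool using (Bool; true; false; not; if_then_else_)
open import Data.Fin using (Fin; toℕ; fromℕ; inject₁; punchIn)
open import Data.Product using (Σ; ∃; _×_; _,_)
open import Data.Sum using (_⊎_)
open import Relation.Binary.PropositionalEquality using (_≡_; _≢_)
open import Function.Bundles using (_⇔_)

-- Teams are Fin (suc N) (index 0 = strongest; i stronger than j iff toℕ i < toℕ j),
-- rounds are Fin N (round r+1 of the paper is index r).  In the application N = n - 1.
-- A schedule assigns to each pair of distinct teams a round and a home team;
-- it is given on ordered pairs, required symmetric (round) / antisymmetric (home).
-- home i j ≡ true  means: team i plays at home in its game against j.
-- Values on the diagonal (i = j) are meaningless and never used.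
record Schedule (N : ℕ) : Set where
  field
    rnd       : Fin (suc N) → Fin (suc N) → Fin N
    home      : Fin (suc N) → Fin (suc N) → Bool
    rnd-sym   : ∀ i j → rnd i j ≡ rnd j i
    home-anti : ∀ i j → i ≢ j → home j i ≡ not (home i j)

module _ {N : ℕ} (S : Schedule N) where
  open Schedule S

  Feasible : Set
  Feasible = ∀ (i : Fin (suc N)) (r : Fin N) →
    ∃ λ j → (j ≢ i × rnd i j ≡ r) ×
            (∀ j′ → j′ ≢ i → rnd i j′ ≡ r → j′ ≡ j)

  PlaysAt : Fin (suc N) → Fin N → Bool → Set
  PlaysAt i r b = ∃ λ j → j ≢ i × rnd i j ≡ r × home i j ≡ b

prev : ∀ {N} → Fin N → Fin N
prev {suc N} Fin.zero    = fromℕ N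
prev {suc N} (Fin.suc r) = inject₁ r

module _ {N : ℕ} (S : Schedule N) where
  open Schedule S

  Break : Fin (suc N) → Fin N → Set
  Break i r = ∃ λ b → PlaysAt S i (prev r) b × PlaysAt S i r b

  SingleBreak : Set
  SingleBreak = ∀ i → ∃ λ r → Break i r × (∀ r′ → Break i r′ → r′ ≡ r)

  BreakRound : Fin N → Set
  BreakRound r = ∃ λ i → Break i r

  -- ranking HAP of team i: its venue against its m-th strongest opponent,
  -- the opponents in increasing index order being  punchIn i 0, punchIn i 1, …
  rankingHAP : Fin (suc N) → Fin N → Bool
  rankingHAP i m = home i (punchIn i m)

  RankingFair : Set
  RankingFair = ∀ i (a b : Fin N) → toℕ b ≡ suc (toℕ a) →
                rankingHAP i a ≢ rankingHAP i b

  -- d : Fin k → ℕ is the D-sequence of S : the break rounds, listed in strictly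
  -- increasing order, are rs 0 < rs 1 < … < rs (k-1), and d a = r_{a+1} - r_a
  -- with r_k := r_0 + N  (N = n - 1 rounds).
  DSequence : (k : ℕ) → (Fin k → ℕ) → Set
  DSequence k d = Σ (Fin k → Fin N) λ rs →
      (∀ a b → toℕ a < toℕ b → toℕ (rs a) < toℕ (rs b)) ×
      (∀ r → BreakRound r ⇔ (∃ λ a → rs a ≡ r)) ×
      (∀ a b → toℕ b ≡ suc (toℕ a) → d a ≡ toℕ (rs b) ∸ toℕ (rs a)) ×
      (∀ a z → toℕ a ≡ k ∸ 1 → toℕ z ≡ 0 → d a ≡ (toℕ (rs z) + N) ∸ toℕ (rs a))

canon : ℕ → ℕ → ℕ
canon k j = if j ≡ᵇ (k ∸ 1) then 1 else 2

-- reduction of x < 2k into [0,k)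
cyc : ℕ → ℕ → ℕ
cyc k x = if x <ᵇ k then x else x ∸ k

IsRotationOfCanon : (k : ℕ) → (Fin k → ℕ) → Set
IsRotationOfCanon k d = ∃ λ s → s < k × (∀ a → d a ≡ canon k (cyc k (toℕ a + s)))

IsReversedRotationOfCanon : (k : ℕ) → (Fin k → ℕ) → Set
IsReversedRotationOfCanon k d =
  ∃ λ s → s < k × (∀ a → d a ≡ canon k (cyc k ((k ∸ 1 ∸ toℕ a) + s)))

module Submission where

-- Count rounds from the first of the two consecutive break rounds (the gap 1 of the
-- D-sequence): every team then breaks at offset 0 or at an odd offset.  A single break makes a
-- team's venues alternate along the rounds, ranking fairness makes them alternate along its
-- opponents ordered by strength, and as the number N = n - 1 of rounds is odd both patterns
-- start with the same venue.  So team v is in phase in round p (p lies at even distance after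
-- its break) iff its opponent w there is odd when w > v and even when w < v.  Two teams of
-- equal parity playing each other are never both in phase, so they break in different rounds,
-- and in the two rounds at distance 2j+1 from the origin at most 2j+2 teams are in phase.
-- Teams 0 and N always meet an in-phase opponent; counting in rounds 1 and N-1 forces teams 2
-- and N-2 to meet teams below resp. above them there, hence in-phase opponents in all other
-- rounds, and repeating this in rounds 3, N-3 and 5, N-5 shows that teams 2, 4 and 6 all
-- break at offset 0 or 1: two of them share a break round.

open import Defs
open import Data.Bool using (Bool; true; false; not; _xor_; if_then_else_; T)
import Data.Bool as Bool
open import Data.Bool.Properties using (not-involutive; not-injective; ¬-not; not-¬; xor-same; xor-identityʳ;
  xor-assoc; xor-comm; true-xor; not-distribʳ-xor)
open import Data.Empty using (⊥; ⊥-elim)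
open import Data.Fin using (Fin; zero; suc; toℕ; fromℕ<; inject₁; punchIn; punchOut)
open import Data.Fin.Properties using (pigeonhole; toℕ-injective; toℕ<n; toℕ-fromℕ<; toℕ-fromℕ; toℕ-inject₁;
  punchIn-punchOut; punchIn-injective; punchInᵢ≢i)
open import Data.Nat using (ℕ; zero; suc; _+_; _*_; _∸_; _≤_; _<_; z≤n; s≤s; z<s; ⌊_/2⌋; NonZero; _<ᵇ_; _≡ᵇ_; _/_)
open import Data.Nat.DivMod using (_%_; _mod_; m%n<n; m%n%n≡m%n; %-distribˡ-+; [m+n]%n≡m%n; m<n⇒m%n≡m)
open import Data.Nat.Divisibility using (_∣_; divides)
open import Data.Nat.Properties
open import Data.Nat.Tactic.RingSolver using (solve-∀)
open import Data.Product using (∃; _×_; _,_; proj₁; proj₂)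
open import Data.Sum using (_⊎_; inj₁; inj₂; [_,_])
open import Data.Vec using (Vec; []; _∷_; lookup)
open import Data.Vec.Relation.Unary.All as All using (All; []; _∷_)
open import Data.Vec.Relation.Unary.All.Properties using (lookup⁺)
open import Data.Vec.Relation.Unary.AllPairs using ([]; _∷_)
open import Data.Vec.Relation.Unary.Unique.Propositional using (Unique)
open import Data.Vec.Relation.Unary.Unique.Propositional.Properties using (lookup-injective)
open import Function using (_∘_)
open import Function.Bundles using (Equivalence)
open import Function.Definitions using (Injective)
open import Relation.Binary.Definitions using (tri<; tri≈; tri>)
open import Relation.Binary.PropositionalEquality
  using (_≡_; _≢_; refl; sym; trans; cong; cong₂; subst; module ≡-Reasoning)
open import Relation.Nullary using (¬_; yes; no; contradiction)

-- Parity

odd : ℕ → Bool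
odd zero          = false
odd (suc zero)    = true
odd (suc (suc n)) = odd n

odd-suc : ∀ n → odd (suc n) ≡ not (odd n)
odd-suc zero          = refl
odd-suc (suc zero)    = refl
odd-suc (suc (suc n)) = odd-suc n

odd-+ : ∀ m n → odd (m + n) ≡ odd m xor odd n
odd-+ zero          n = refl
odd-+ (suc zero)    n = odd-suc n
odd-+ (suc (suc m)) n = odd-+ m n

odd-∸ : ∀ {m n} → n ≤ m → odd (m ∸ n) ≡ odd m xor odd n
odd-∸ {m} {n} n≤m = begin
  odd (m ∸ n)                          ≡⟨ sym (xor-identityʳ _) ⟩
  odd (m ∸ n) xor false                ≡⟨ cong (odd (m ∸ n) xor_) (sym (xor-same (odd n))) ⟩
  odd (m ∸ n) xor (odd n xor odd n)    ≡⟨ sym (xor-assoc (odd (m ∸ n)) _ _) ⟩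
  (odd (m ∸ n) xor odd n) xor odd n    ≡⟨ cong (_xor odd n) (sym (odd-+ (m ∸ n) n)) ⟩
  odd (m ∸ n + n) xor odd n            ≡⟨ cong (λ x → odd x xor odd n) (m∸n+n≡m n≤m) ⟩
  odd m xor odd n                      ∎
  where open ≡-Reasoning

odd-double : ∀ n → odd (n + n) ≡ false
odd-double n = trans (odd-+ n n) (xor-same (odd n))

odd-suc-double : ∀ n → odd (suc (n + n)) ≡ true
odd-suc-double n = trans (odd-suc (n + n)) (cong not (odd-double n))

⌊n/2⌋-odd : ∀ {n} → odd n ≡ true → n ≡ suc (⌊ n /2⌋ + ⌊ n /2⌋)
⌊n/2⌋-odd {suc zero}    _ = refl
⌊n/2⌋-odd {suc (suc n)} o = cong (2 +_) (trans (⌊n/2⌋-odd o) (sym (+-suc _ _)))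

⌊n/2⌋-even : ∀ {n} → odd n ≡ false → n ≡ ⌊ n /2⌋ + ⌊ n /2⌋
⌊n/2⌋-even {zero}        _ = refl
⌊n/2⌋-even {suc (suc n)} e = cong suc (trans (cong suc (⌊n/2⌋-even e)) (sym (+-suc _ _)))

xor-flip : ∀ b x y → b xor x ≡ not b xor y → y ≡ not x
xor-flip false x y eq = trans (sym (not-involutive y)) (cong not (sym eq))
xor-flip true  x y eq = sym eq

xor-cancelˡ : ∀ b {x y} → b xor x ≡ b xor y → x ≡ y
xor-cancelˡ false eq = eq
xor-cancelˡ true  eq = not-injective eq

2∣⇒odd≡false : ∀ {n} → 2 ∣ n → odd n ≡ false
2∣⇒odd≡false (divides q refl) = even-double q
  where
  even-double : ∀ q → odd (q * 2) ≡ false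
  even-double zero    = refl
  even-double (suc q) = even-double q

-- Counting

injection-bound : ∀ {k K} (g : Fin k → ℕ) → (∀ a → g a < K) → Injective _≡_ _≡_ g → k ≤ K
injection-bound {k} {K} g g<K g-inj with k ≤? K
... | yes k≤K = k≤K
... | no  k≰K with pigeonhole (≰⇒> k≰K) (λ a → fromℕ< (g<K a))
...   | i , j , i<j , same = contradiction (cong toℕ (g-inj g≡)) (<⇒≢ i<j)
  where
  g≡ : g i ≡ g j
  g≡ = trans (sym (toℕ-fromℕ< (g<K i))) (trans (cong toℕ same) (toℕ-fromℕ< (g<K j)))

odd-injection-bound : ∀ {k s} (g : Fin k → ℕ) → (∀ a → odd (g a) ≡ true) → (∀ a → g a < s + s) →
                      Injective _≡_ _≡_ g → k ≤ s
odd-injection-bound {s = s} g odd-g g<2s g-inj = injection-bound (λ a → ⌊ g a /2⌋) half<s half-inj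
  where
  half<s : ∀ a → ⌊ g a /2⌋ < s
  half<s a with s ≤? ⌊ g a /2⌋
  ... | no  s≰ = ≰⇒> s≰
  ... | yes s≤ = contradiction (subst (_< s + s) (⌊n/2⌋-odd (odd-g a)) (g<2s a))
                               (≤⇒≯ (≤-trans (+-mono-≤ s≤ s≤) (n≤1+n _)))
  half-inj : Injective _≡_ _≡_ (λ a → ⌊ g a /2⌋)
  half-inj {a} {b} eq = g-inj (begin
    g a                              ≡⟨ ⌊n/2⌋-odd (odd-g a) ⟩
    suc (⌊ g a /2⌋ + ⌊ g a /2⌋)      ≡⟨ cong (λ h → suc (h + h)) eq ⟩
    suc (⌊ g b /2⌋ + ⌊ g b /2⌋)      ≡⟨ ⌊n/2⌋-odd (odd-g b) ⟨
    g b                              ∎)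
    where open ≡-Reasoning

two-per-class-bound : ∀ {k K} (c : Fin k → ℕ) (b : Fin k → Bool) → (∀ a → c a < K) →
              (∀ {a a′} → c a ≡ c a′ → b a ≡ b a′ → a ≡ a′) → k ≤ K + K
two-per-class-bound {K = K} c b c<K c,b-inj = injection-bound code code< code-inj
  where
  shift : Bool → ℕ
  shift β = if β then K else 0
  code : _ → ℕ
  code a = shift (b a) + c a
  code< : ∀ a → code a < K + K
  code< a with b a
  ... | true  = +-monoʳ-< K (c<K a)
  ... | false = <-≤-trans (c<K a) (m≤m+n K K)
  split : ∀ β β′ {u v} → u < K → v < K → shift β + u ≡ shift β′ + v → β ≡ β′ × u ≡ v
  split false false _   _   eq = refl , eq
  split true  true  _   _   eq = refl , +-cancelˡ-≡ K _ _ eq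
  split true  false _   v<K eq = contradiction (subst (K ≤_) eq (m≤m+n K _)) (<⇒≱ v<K)
  split false true  u<K _   eq = contradiction (subst (K ≤_) (sym eq) (m≤m+n K _)) (<⇒≱ u<K)
  code-inj : Injective _≡_ _≡_ code
  code-inj {a} {a′} eq with split (b a) (b a′) (c<K a) (c<K a′) eq
  ... | b≡ , c≡ = c,b-inj c≡ b≡

no-parity-reversing-injection : ∀ {n} → odd n ≡ true → (g : Fin n → ℕ) → (∀ a → g a < n) →
  (∀ a → odd (g a) ≡ not (odd (toℕ a))) → Injective _≡_ _≡_ g → ⊥
no-parity-reversing-injection {n} odd-n g g<n g-flips g-inj =
  contradiction (odd-injection-bound h odd-h h< h-inj) (<-irrefl refl)
  where
  M : ℕ
  M = ⌊ n /2⌋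
  n≡ : n ≡ suc (M + M)
  n≡ = ⌊n/2⌋-odd odd-n
  2e< : ∀ (e : Fin (suc M)) → toℕ e + toℕ e < n
  2e< e = subst (toℕ e + toℕ e <_) (sym n≡) (s≤s (+-mono-≤ (≤-pred (toℕ<n e)) (≤-pred (toℕ<n e))))
  h : Fin (suc M) → ℕ
  h e = g (fromℕ< (2e< e))
  odd-h : ∀ e → odd (h e) ≡ true
  odd-h e = trans (g-flips _) (trans (cong (λ x → not (odd x)) (toℕ-fromℕ< (2e< e))) (cong not (odd-double (toℕ e))))
  h< : ∀ e → h e < M + M
  h< e = ≤∧≢⇒< (≤-pred (subst (h e <_) n≡ (g<n _)))
                λ h≡ → contradiction (trans (sym (odd-h e)) (trans (cong odd h≡) (odd-double M))) λ ()
  h-inj : Injective _≡_ _≡_ h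
  h-inj {e} {e′} eq = toℕ-injective (begin
    toℕ e                          ≡⟨ n≡⌊n+n/2⌋ (toℕ e) ⟩
    ⌊ toℕ e + toℕ e /2⌋            ≡⟨ cong ⌊_/2⌋ (toℕ-fromℕ< (2e< e)) ⟨
    ⌊ toℕ (fromℕ< (2e< e)) /2⌋     ≡⟨ cong (λ x → ⌊ toℕ x /2⌋) (g-inj eq) ⟩
    ⌊ toℕ (fromℕ< (2e< e′)) /2⌋    ≡⟨ cong ⌊_/2⌋ (toℕ-fromℕ< (2e< e′)) ⟩
    ⌊ toℕ e′ + toℕ e′ /2⌋          ≡⟨ n≡⌊n+n/2⌋ (toℕ e′) ⟨
    toℕ e′                         ∎)
    where open ≡-Reasoning

injective-on-lookup : ∀ {k} {P : ℕ → Set} (f : ℕ → ℕ) (xs : Vec ℕ k) →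
  (∀ {x y} → P x → P y → f x ≡ f y → x ≡ y) → All P xs → Unique xs →
  Injective _≡_ _≡_ (λ a → f (lookup xs a))
injective-on-lookup f xs f-inj Pxs xs-unique {a} {b} eq =
  lookup-injective xs-unique a b (f-inj (lookup⁺ Pxs a) (lookup⁺ Pxs b) eq)

-- Distances on the cycle of rounds

module Cyclic (N : ℕ) .{{_ : NonZero N}} where

  %-absorbˡ : ∀ m n → (m % N + n) % N ≡ (m + n) % N
  %-absorbˡ m n = begin
    (m % N + n) % N            ≡⟨ %-distribˡ-+ (m % N) n N ⟩
    (m % N % N + n % N) % N    ≡⟨ cong (λ x → (x + n % N) % N) (m%n%n≡m%n m N) ⟩
    (m % N + n % N) % N        ≡⟨ %-distribˡ-+ m n N ⟨
    (m + n) % N                ∎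
    where open ≡-Reasoning

  -- Opaque, so that unification sees dist q p rather than an unfolded modulus computation.
  opaque
    dist : ℕ → ℕ → ℕ
    dist q p = (p + (N ∸ q)) % N

    dist-< : ∀ q p → dist q p < N
    dist-< q p = m%n<n _ N

    dist-%ʳ : ∀ q p → dist q (p % N) ≡ dist q p
    dist-%ʳ q p = %-absorbˡ p (N ∸ q)

    dist-+ : ∀ {q} d → q ≤ N → dist q (q + d) ≡ d % N
    dist-+ {q} d q≤N = begin
      (q + d + (N ∸ q)) % N      ≡⟨ cong (_% N) (trans (cong (_+ (N ∸ q)) (+-comm q d)) (+-assoc d q _)) ⟩
      (d + (q + (N ∸ q))) % N    ≡⟨ cong (λ x → (d + x) % N) (m+[n∸m]≡n q≤N) ⟩
      (d + N) % N                ≡⟨ [m+n]%n≡m%n d N ⟩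
      d % N                      ∎
      where open ≡-Reasoning

    +-dist : ∀ {q} p → q ≤ N → (q + dist q p) % N ≡ p % N
    +-dist {q} p q≤N = begin
      (q + (p + (N ∸ q)) % N) % N    ≡⟨ cong (_% N) (+-comm q _) ⟩
      ((p + (N ∸ q)) % N + q) % N    ≡⟨ %-absorbˡ (p + (N ∸ q)) q ⟩
      (p + (N ∸ q) + q) % N          ≡⟨ cong (_% N) (+-assoc p _ q) ⟩
      (p + ((N ∸ q) + q)) % N        ≡⟨ cong (λ x → (p + x) % N) (m∸n+n≡m q≤N) ⟩
      (p + N) % N                    ≡⟨ [m+n]%n≡m%n p N ⟩
      p % N                          ∎
      where open ≡-Reasoning

    dist-≤ : ∀ {q p} → q ≤ p → p < N → dist q p ≡ p ∸ q
    dist-≤ {q} {p} q≤p p<N = begin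
      (p + (N ∸ q)) % N      ≡⟨ cong (_% N) (+-∸-assoc p (≤-trans q≤p (<⇒≤ p<N))) ⟨
      (p + N ∸ q) % N        ≡⟨ cong (_% N) (+-∸-comm N q≤p) ⟩
      (p ∸ q + N) % N        ≡⟨ [m+n]%n≡m%n (p ∸ q) N ⟩
      (p ∸ q) % N            ≡⟨ m<n⇒m%n≡m (≤-<-trans (m∸n≤m p q) p<N) ⟩
      p ∸ q                  ∎
      where open ≡-Reasoning

    dist-> : ∀ {q p} → p < q → q ≤ N → dist q p ≡ p + (N ∸ q)
    dist-> {q} {p} p<q q≤N = m<n⇒m%n≡m (begin-strict
      p + (N ∸ q)   <⟨ +-monoˡ-< (N ∸ q) p<q ⟩
      q + (N ∸ q)   ≡⟨ m+[n∸m]≡n q≤N ⟩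
      N             ∎)
      where open ≤-Reasoning

  odd-dist-≤ : ∀ {q p} → q ≤ p → p < N → odd (dist q p) ≡ odd p xor odd q
  odd-dist-≤ q≤p p<N = trans (cong odd (dist-≤ q≤p p<N)) (odd-∸ q≤p)

  odd-dist-> : odd N ≡ true → ∀ {q p} → p < q → q ≤ N → odd (dist q p) ≡ not (odd p xor odd q)
  odd-dist-> odd-N {q} {p} p<q q≤N = begin
    odd (dist q p)                 ≡⟨ cong odd (dist-> p<q q≤N) ⟩
    odd (p + (N ∸ q))              ≡⟨ odd-+ p (N ∸ q) ⟩
    odd p xor odd (N ∸ q)          ≡⟨ cong (odd p xor_) (trans (odd-∸ q≤N) (cong (_xor odd q) odd-N)) ⟩
    odd p xor not (odd q)          ≡⟨ not-distribʳ-xor (odd p) (odd q) ⟨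
    not (odd p xor odd q)          ∎
    where open ≡-Reasoning

  alternating-walk : (G : ℕ → Bool) {q : ℕ} → q < N → (∀ {x y} → x % N ≡ y % N → G x ≡ G y) →
    (∀ y → suc y % N ≢ q % N → G (suc y) ≢ G y) → ∀ p → G p ≡ G q xor odd (dist q p)
  alternating-walk G {q} q<N G-periodic G-alternates p = begin
    G p                              ≡⟨ G-periodic (+-dist p (<⇒≤ q<N)) ⟨
    G (q + dist q p)                 ≡⟨ walk (dist q p) (dist-< q p) ⟩
    G q xor odd (dist q p)           ∎
    where
    open ≡-Reasoning
    returns : ∀ {d} → suc d < N → suc (q + d) % N ≢ q % N
    returns {d} sd<N eq = contradiction (begin
      suc d                          ≡⟨ m<n⇒m%n≡m sd<N ⟨
      suc d % N                      ≡⟨ dist-+ (suc d) (<⇒≤ q<N) ⟨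
      dist q (q + suc d)             ≡⟨ cong (dist q) (+-suc q d) ⟩
      dist q (suc (q + d))           ≡⟨ dist-%ʳ q _ ⟨
      dist q (suc (q + d) % N)       ≡⟨ cong (dist q) eq ⟩
      dist q (q % N)                 ≡⟨ dist-%ʳ q q ⟩
      dist q q                       ≡⟨ dist-≤ ≤-refl q<N ⟩
      q ∸ q                          ≡⟨ n∸n≡0 q ⟩
      0                              ∎) λ ()
    walk : ∀ d → d < N → G (q + d) ≡ G q xor odd d
    walk zero    _     = trans (cong G (+-identityʳ q)) (sym (xor-identityʳ (G q)))
    walk (suc d) sd<N  = begin
      G (q + suc d)                  ≡⟨ cong G (+-suc q d) ⟩
      G (suc (q + d))                ≡⟨ ¬-not (G-alternates (q + d) (returns sd<N)) ⟩
      not (G (q + d))                ≡⟨ cong not (walk d (<-trans (n<1+n d) sd<N)) ⟩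
      not (G q xor odd d)            ≡⟨ not-distribʳ-xor (G q) (odd d) ⟩
      G q xor not (odd d)            ≡⟨ cong (G q xor_) (odd-suc d) ⟨
      G q xor odd (suc d)            ∎

  evenGap : ℕ → ℕ → Bool
  evenGap q p = not (odd (dist q p))

  evenGap-zero : ∀ {p} → p < N → evenGap 0 p ≡ not (odd p)
  evenGap-zero p<N = cong not (trans (odd-dist-≤ z≤n p<N) (xor-identityʳ _))

  evenGap-before : odd N ≡ true → ∀ {q p} → odd q ≡ true → p < q → q ≤ N → evenGap q p ≡ not (odd p)
  evenGap-before odd-N {q} {p} odd-q p<q q≤N = begin
    not (odd (dist q p))            ≡⟨ cong not (odd-dist-> odd-N p<q q≤N) ⟩
    not (not (odd p xor odd q))     ≡⟨ not-involutive _ ⟩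
    odd p xor odd q                 ≡⟨ cong (odd p xor_) odd-q ⟩
    odd p xor true                  ≡⟨ xor-comm (odd p) true ⟩
    true xor odd p                  ≡⟨ true-xor (odd p) ⟩
    not (odd p)                     ∎
    where open ≡-Reasoning

  evenGap-after : ∀ {q p} → odd q ≡ true → q ≤ p → p < N → evenGap q p ≡ odd p
  evenGap-after {q} {p} odd-q q≤p p<N = begin
    not (odd (dist q p))            ≡⟨ cong not (odd-dist-≤ q≤p p<N) ⟩
    not (odd p xor odd q)           ≡⟨ cong (λ b → not (odd p xor b)) odd-q ⟩
    not (odd p xor true)            ≡⟨ cong not (trans (xor-comm (odd p) true) (true-xor (odd p))) ⟩
    not (not (odd p))               ≡⟨ not-involutive (odd p) ⟩
    odd p                           ∎
    where open ≡-Reasoning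

  dist-injectiveʳ : ∀ {r p p′} → r ≤ N → p < N → p′ < N → dist r p ≡ dist r p′ → p ≡ p′
  dist-injectiveʳ {r} {p} {p′} r≤N p<N p′<N eq = begin
    p                     ≡⟨ m<n⇒m%n≡m p<N ⟨
    p % N                 ≡⟨ +-dist p r≤N ⟨
    (r + dist r p) % N    ≡⟨ cong (λ d → (r + d) % N) eq ⟩
    (r + dist r p′) % N   ≡⟨ +-dist p′ r≤N ⟩
    p′ % N                ≡⟨ m<n⇒m%n≡m p′<N ⟩
    p′                    ∎
    where open ≡-Reasoning

  EvenWithin : ℕ → ℕ → ℕ → Set
  EvenWithin j r q = odd (dist r q) ≡ false × dist r q ≤ j + j

-- Tournaments seen from an origin round

-- Teams are 0 … N by decreasing strength and rounds are the offsets 0 … N-1 from a fixed origin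
-- round; rival v p is v's opponent in round p and breakOffset v the offset of v's break round.
-- The laws inPhase-up/down say that v is in phase in round p iff the rival has even position
-- (w - 1 if w > v, w if w < v) in v's list of opponents ordered by strength.
record Tournament (N : ℕ) .{{_ : NonZero N}} : Set where
  open Cyclic N
  field
    rival            : ℕ → ℕ → ℕ
    breakOffset      : ℕ → ℕ
    rival-≤          : ∀ {v p} → v ≤ N → p < N → rival v p ≤ N
    rival-≢          : ∀ {v p} → v ≤ N → p < N → rival v p ≢ v
    rival-involutive : ∀ {v p} → v ≤ N → p < N → rival (rival v p) p ≡ v
    rival-injectiveʳ : ∀ {v p p′} → v ≤ N → p < N → p′ < N → rival v p ≡ rival v p′ → p ≡ p′
    rival-meets      : ∀ {v w} → v ≤ N → w ≤ N → v ≢ w → ∃ λ p → p < N × rival v p ≡ w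
    breakOffset-<    : ∀ {v} → v ≤ N → breakOffset v < N
    inPhase-up       : ∀ {v p} → v ≤ N → p < N → v < rival v p →
                       evenGap (breakOffset v) p ≡ odd (rival v p)
    inPhase-down     : ∀ {v p} → v ≤ N → p < N → rival v p < v →
                       evenGap (breakOffset v) p ≡ not (odd (rival v p))

  inPhase : ℕ → ℕ → Bool
  inPhase v p = evenGap (breakOffset v) p

  rival-injectiveˡ : ∀ {v w p} → v ≤ N → w ≤ N → p < N → rival v p ≡ rival w p → v ≡ w
  rival-injectiveˡ {v} {w} {p} v≤N w≤N p<N eq = begin
    v                    ≡⟨ rival-involutive v≤N p<N ⟨
    rival (rival v p) p  ≡⟨ cong (λ u → rival u p) eq ⟩
    rival (rival w p) p  ≡⟨ rival-involutive w≤N p<N ⟩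
    w                    ∎
    where open ≡-Reasoning

  rival-inPhase-up : ∀ {v p} → v ≤ N → p < N → v < rival v p → inPhase (rival v p) p ≡ not (odd v)
  rival-inPhase-up {v} {p} v≤N p<N v<w = begin
    inPhase (rival v p) p               ≡⟨ inPhase-down (rival-≤ v≤N p<N) p<N (subst (_< rival v p) (sym back) v<w) ⟩
    not (odd (rival (rival v p) p))     ≡⟨ cong (λ u → not (odd u)) back ⟩
    not (odd v)                         ∎
    where
    open ≡-Reasoning
    back = rival-involutive v≤N p<N

  rival-inPhase-down : ∀ {v p} → v ≤ N → p < N → rival v p < v → inPhase (rival v p) p ≡ odd v
  rival-inPhase-down {v} {p} v≤N p<N w<v = begin
    inPhase (rival v p) p               ≡⟨ inPhase-up (rival-≤ v≤N p<N) p<N (subst (rival v p <_) (sym back) w<v) ⟩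
    odd (rival (rival v p) p)           ≡⟨ cong odd back ⟩
    odd v                               ∎
    where
    open ≡-Reasoning
    back = rival-involutive v≤N p<N

  even-plays-down : ∀ {v p} → v ≤ N → p < N → odd v ≡ false → inPhase (rival v p) p ≡ false → rival v p < v
  even-plays-down {v} {p} v≤N p<N even-v out with <-cmp (rival v p) v
  ... | tri< w<v _ _ = w<v
  ... | tri≈ _ w≡v _ = contradiction w≡v (rival-≢ v≤N p<N)
  ... | tri> _ _ v<w = contradiction (trans (sym out) (trans (rival-inPhase-up v≤N p<N v<w) (cong not even-v))) λ ()

  odd-plays-up : ∀ {v p} → v ≤ N → p < N → odd v ≡ true → inPhase (rival v p) p ≡ false → v < rival v p
  odd-plays-up {v} {p} v≤N p<N odd-v out with <-cmp (rival v p) v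
  ... | tri< w<v _ _ = contradiction (trans (sym out) (trans (rival-inPhase-down v≤N p<N w<v) odd-v)) λ ()
  ... | tri≈ _ w≡v _ = contradiction w≡v (rival-≢ v≤N p<N)
  ... | tri> _ _ v<w = v<w

  breakOffset-separates-< : ∀ {v w} → v ≤ N → w ≤ N → v < w → odd v ≡ odd w → breakOffset v ≢ breakOffset w
  breakOffset-separates-< {v} {w} v≤N w≤N v<w same-parity same-offset with rival-meets v≤N w≤N (<⇒≢ v<w)
  ... | p , p<N , refl = not-¬ refl (begin
    odd (rival v p)               ≡⟨ inPhase-up v≤N p<N v<w ⟨
    inPhase v p                   ≡⟨ cong (λ q → evenGap q p) same-offset ⟩
    inPhase (rival v p) p         ≡⟨ rival-inPhase-up v≤N p<N v<w ⟩
    not (odd v)                   ≡⟨ cong not same-parity ⟩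
    not (odd (rival v p))         ∎)
    where open ≡-Reasoning

  breakOffset-separates : ∀ {v w} → v ≤ N → w ≤ N → v ≢ w → odd v ≡ odd w → breakOffset v ≢ breakOffset w
  breakOffset-separates {v} {w} v≤N w≤N v≢w same-parity with <-cmp v w
  ... | tri< v<w _ _ = breakOffset-separates-< v≤N w≤N v<w same-parity
  ... | tri≈ _ v≡w _ = contradiction v≡w v≢w
  ... | tri> _ _ w<v = breakOffset-separates-< w≤N v≤N w<v (sym same-parity) ∘ sym

  window-bound : ∀ {k j r} → r ≤ N → (ws : Fin k → ℕ) → Injective _≡_ _≡_ ws → (∀ a → ws a ≤ N) →
    (∀ a → EvenWithin j r (breakOffset (ws a))) → k ≤ suc j + suc j
  window-bound {j = j} {r} r≤N ws ws-inj ws≤N window =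
    two-per-class-bound (λ a → ⌊ gap a /2⌋) (λ a → odd (ws a)) class< class-inj
    where
    gap : _ → ℕ
    gap a = dist r (breakOffset (ws a))
    class< : ∀ a → ⌊ gap a /2⌋ < suc j
    class< a with window a
    ... | _ , gap≤2j = s≤s (subst (⌊ gap a /2⌋ ≤_) (sym (n≡⌊n+n/2⌋ j)) (⌊n/2⌋-mono gap≤2j))
    class-inj : ∀ {a a′} → ⌊ gap a /2⌋ ≡ ⌊ gap a′ /2⌋ → odd (ws a) ≡ odd (ws a′) → a ≡ a′
    class-inj {a} {a′} half≡ parity≡ with ws a ≟ ws a′
    ... | yes ws≡ = ws-inj ws≡
    ... | no  ws≢ = contradiction same-offset (breakOffset-separates (ws≤N a) (ws≤N a′) ws≢ parity≡)
      where
      same-gap : gap a ≡ gap a′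
      same-gap = begin
        gap a                        ≡⟨ ⌊n/2⌋-even (proj₁ (window a)) ⟩
        ⌊ gap a /2⌋ + ⌊ gap a /2⌋    ≡⟨ cong (λ h → h + h) half≡ ⟩
        ⌊ gap a′ /2⌋ + ⌊ gap a′ /2⌋  ≡⟨ ⌊n/2⌋-even (proj₁ (window a′)) ⟨
        gap a′                       ∎
        where open ≡-Reasoning
      same-offset : breakOffset (ws a) ≡ breakOffset (ws a′)
      same-offset = dist-injectiveʳ r≤N (breakOffset-< (ws≤N a)) (breakOffset-< (ws≤N a′)) same-gap

  RivalInPhase : ℕ → ℕ → Set
  RivalInPhase p e = inPhase (rival e p) p ≡ true

  OutOfPhaseRival : ℕ → ℕ → Set
  OutOfPhaseRival x p = p < N × inPhase (rival x p) p ≡ false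

  plays-down-in : ∀ {k x} {E : Vec ℕ k} → x ≤ N → odd x ≡ false → All (OutOfPhaseRival x) E →
    All (λ p → rival x p < x) E
  plays-down-in x≤N even-x = All.map λ (p<N , out) → even-plays-down x≤N p<N even-x out

  plays-up-in : ∀ {k x} {E : Vec ℕ k} → x ≤ N → odd x ≡ true → All (OutOfPhaseRival x) E →
    All (λ p → x < rival x p) E
  plays-up-in x≤N odd-x = All.map λ (p<N , out) → odd-plays-up x≤N p<N odd-x out

  exhausted-below⇒rival-inPhase : ∀ {e p} → e ≤ N → odd e ≡ false → (ps : Vec ℕ e) → Unique ps →
    All (_< N) ps → All (λ p′ → rival e p′ < e) ps → p < N → All (p ≢_) ps → RivalInPhase p e
  exhausted-below⇒rival-inPhase {e} {p} e≤N even-e ps ps-unique ps<N below p<N p∉ps with <-cmp (rival e p) e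
  ... | tri< w<e _ _ = contradiction (injection-bound rivals (lookup⁺ (w<e ∷ below)) rivals-inj) (<-irrefl refl)
    where
    rivals : Fin (suc e) → ℕ
    rivals a = rival e (lookup (p ∷ ps) a)
    rivals-inj : Injective _≡_ _≡_ rivals
    rivals-inj = injective-on-lookup (rival e) (p ∷ ps) (rival-injectiveʳ e≤N) (p<N ∷ ps<N) (p∉ps ∷ ps-unique)
  ... | tri≈ _ w≡e _ = contradiction w≡e (rival-≢ e≤N p<N)
  ... | tri> _ _ e<w = trans (rival-inPhase-up e≤N p<N e<w) (cong not even-e)

  exhausted-above⇒rival-inPhase : ∀ {k e p} → e ≤ N → odd e ≡ true → (ps : Vec ℕ k) → k + e ≡ N → Unique ps →
    All (_< N) ps → All (λ p′ → e < rival e p′) ps → p < N → All (p ≢_) ps → RivalInPhase p e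
  exhausted-above⇒rival-inPhase {k} {e} {p} e≤N odd-e ps k+e≡N ps-unique ps<N above p<N p∉ps with <-cmp (rival e p) e
  ... | tri< w<e _ _ = trans (rival-inPhase-down e≤N p<N w<e) odd-e
  ... | tri≈ _ w≡e _ = contradiction w≡e (rival-≢ e≤N p<N)
  ... | tri> _ _ e<w = contradiction (injection-bound room room<k room-inj) (<-irrefl refl)
    where
    room : Fin (suc k) → ℕ
    room a = N ∸ rival e (lookup (p ∷ ps) a)
    room<k : ∀ a → room a < k
    room<k a = subst (room a <_) (trans (cong (_∸ e) (sym k+e≡N)) (m+n∸n≡m k e))
                 (∸-monoʳ-< {N} (lookup⁺ (e<w ∷ above) a) (rival-≤ e≤N (lookup⁺ (p<N ∷ ps<N) a)))
    room-inj : Injective _≡_ _≡_ room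
    room-inj = injective-on-lookup (λ p′ → N ∸ rival e p′) (p ∷ ps)
      (λ p′<N p″<N eq → rival-injectiveʳ e≤N p′<N p″<N (∸-cancelˡ-≡ (rival-≤ e≤N p′<N) (rival-≤ e≤N p″<N) eq))
      (p<N ∷ ps<N) (p∉ps ∷ ps-unique)

  odd-rivals-bound : ∀ {k e s} → e ≡ s + s → e ≤ N → (ps : Vec ℕ k) → Unique ps → All (_< N) ps →
    All (λ p → rival e p < e) ps → All (λ p → inPhase e p ≡ false) ps → k ≤ s
  odd-rivals-bound {e = e} refl e≤N ps ps-unique ps<N below out =
    odd-injection-bound (λ a → rival e (lookup ps a)) odd-rival (lookup⁺ below)
      (injective-on-lookup (rival e) ps (rival-injectiveʳ e≤N) ps<N ps-unique)
    where
    odd-rival : ∀ a → odd (rival e (lookup ps a)) ≡ true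
    odd-rival a = not-injective (trans (sym (inPhase-down e≤N (lookup⁺ ps<N a) (lookup⁺ below a))) (lookup⁺ out a))

  same-parity-bound : ∀ {k K} (ts : Vec ℕ k) → Unique ts → All (λ t → t ≤ N × odd t ≡ false) ts →
    All (λ t → breakOffset t < K) ts → k ≤ K
  same-parity-bound ts ts-unique ts-even offsets< =
    injection-bound (λ a → breakOffset (lookup ts a)) (lookup⁺ offsets<)
      (injective-on-lookup breakOffset ts separated ts-even ts-unique)
    where
    separated : ∀ {v w} → v ≤ N × odd v ≡ false → w ≤ N × odd w ≡ false → breakOffset v ≡ breakOffset w → v ≡ w
    separated {v} {w} (v≤N , even-v) (w≤N , even-w) same with v ≟ w
    ... | yes v≡w = v≡w
    ... | no  v≢w = contradiction same (breakOffset-separates v≤N w≤N v≢w (trans even-v (sym even-w)))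

module CanonicalOffsets {m : ℕ} (m-even : odd m ≡ false) (T : Tournament (11 + m))
  (canonical : ∀ {v} → v ≤ 11 + m →
               Tournament.breakOffset T v ≡ 0 ⊎ odd (Tournament.breakOffset T v) ≡ true) where
  open Tournament T
  open Cyclic (11 + m)

  N : ℕ
  N = 11 + m

  odd-N : odd N ≡ true
  odd-N = trans (odd-suc m) (cong not m-even)

  AtDistance : ℕ → ℕ → Set
  AtDistance j p = p ≡ 1 + (j + j) ⊎ 1 + (j + j) + p ≡ N

  inPhase-window-after : ∀ {j v} → 1 + (j + j) < N → v ≤ N → inPhase v (1 + (j + j)) ≡ true →
    EvenWithin j 1 (breakOffset v)
  inPhase-window-after {j} {v} p<N v≤N in-phase
    with breakOffset v | breakOffset-< v≤N | canonical v≤N | in-phase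
  ... | q | q<N | inj₁ refl | in-phase =
    contradiction (trans (sym in-phase) (trans (evenGap-zero p<N) (cong not (odd-suc-double j)))) λ ()
  ... | q | q<N | inj₂ odd-q | in-phase with q ≤? 1 + (j + j)
  ...   | no  q≰p = contradiction (trans (sym in-phase)
                      (trans (evenGap-before odd-N odd-q (≰⇒> q≰p) (<⇒≤ q<N)) (cong not (odd-suc-double j)))) λ ()
  ...   | yes q≤p = trans (odd-dist-≤ 1≤q q<N) (cong (_xor true) odd-q)
                  , subst (_≤ j + j) (sym (dist-≤ 1≤q q<N)) (∸-monoˡ-≤ 1 q≤p)
    where
    1≤q : 1 ≤ q
    1≤q = n≢0⇒n>0 λ { refl → contradiction odd-q λ () }

  even-before : ∀ j {p} → 1 + (j + j) + p ≡ N → odd p ≡ false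
  even-before j {p} N≡ = not-injective (begin
    not (odd p)                    ≡⟨ cong (_xor odd p) (odd-suc-double j) ⟨
    odd (1 + (j + j)) xor odd p    ≡⟨ odd-+ (1 + (j + j)) p ⟨
    odd (1 + (j + j) + p)          ≡⟨ cong odd N≡ ⟩
    odd N                          ≡⟨ odd-N ⟩
    not false                      ∎)
    where open ≡-Reasoning

  rest-before : ∀ j {p} → 1 + (j + j) + p ≡ N → N ∸ suc p ≡ j + j
  rest-before j {p} N≡ = trans (cong (_∸ suc p) (sym N≡)) (m+n∸n≡m (j + j) p)

  inPhase-window-before : ∀ {j p v} → 1 + (j + j) + p ≡ N → p < N → v ≤ N → inPhase v p ≡ true →
    EvenWithin j (suc p) (breakOffset v)
  inPhase-window-before {j} {p} {v} N≡ p<N v≤N in-phase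
    with breakOffset v | breakOffset-< v≤N | canonical v≤N | in-phase
  ... | q | q<N | inj₁ refl | _ = subst (λ d → odd d ≡ false × d ≤ j + j) (sym (trans (dist-> z<s p<N) (rest-before j N≡)))
                                       (odd-double j , ≤-refl)
  ... | q | q<N | inj₂ odd-q | in-phase with q ≤? p
  ...   | yes q≤p = contradiction (trans (sym in-phase) (trans (evenGap-after odd-q q≤p p<N) (even-before j N≡))) λ ()
  ...   | no  q≰p = trans (odd-dist-≤ p<q q<N) (cong₂ _xor_ odd-q (trans (odd-suc p) (cong not (even-before j N≡))))
                  , subst (_≤ j + j) (sym (dist-≤ p<q q<N)) (<⇒≤ (subst (q ∸ suc p <_) (rest-before j N≡) (∸-monoˡ-< q<N p<q)))
    where
    p<q : p < q
    p<q = ≰⇒> q≰p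

  inPhase-bound : ∀ {k} j {p} → AtDistance j p → p < N → (ws : Fin k → ℕ) → Injective _≡_ _≡_ ws →
    (∀ a → ws a ≤ N) → (∀ a → inPhase (ws a) p ≡ true) → k ≤ suc j + suc j
  inPhase-bound j (inj₁ refl) p<N ws ws-inj ws≤N in-phase =
    window-bound {j = j} (s≤s z≤n) ws ws-inj ws≤N λ a → inPhase-window-after {j} p<N (ws≤N a) (in-phase a)
  inPhase-bound j (inj₂ N≡) p<N ws ws-inj ws≤N in-phase =
    window-bound {j = j} p<N ws ws-inj ws≤N λ a → inPhase-window-before {j} N≡ p<N (ws≤N a) (in-phase a)

  outsider-out-of-phase : ∀ j {p x} → AtDistance j p → p < N → (es : Vec ℕ (suc j + suc j)) → Unique es →
    All (_≤ N) es → All (RivalInPhase p) es → x ≤ N → All (x ≢_) es → inPhase (rival x p) p ≡ false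
  outsider-out-of-phase j {p} {x} level p<N es es-unique es≤N es-in x≤N x∉es = ¬-not λ x-in →
    <-irrefl refl (inPhase-bound j level p<N (λ a → rival (lookup (x ∷ es) a) p)
      (injective-on-lookup (λ v → rival v p) (x ∷ es) (λ v≤N w≤N → rival-injectiveˡ v≤N w≤N p<N)
                           (x≤N ∷ es≤N) (x∉es ∷ es-unique))
      (λ a → rival-≤ (lookup⁺ (x≤N ∷ es≤N) a) p<N)
      (lookup⁺ (x-in ∷ es-in)))

  out-of-phase : ∀ {q p} → odd q ≡ true → q < N → p < N →
    (odd p ≡ true × p < q) ⊎ (odd p ≡ false × q ≤ p) → evenGap q p ≡ false
  out-of-phase odd-q q<N p<N (inj₁ (odd-p , p<q)) = trans (evenGap-before odd-N odd-q p<q (<⇒≤ q<N)) (cong not odd-p)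
  out-of-phase odd-q q<N p<N (inj₂ (even-p , q≤p)) = trans (evenGap-after odd-q q≤p p<N) even-p

  large-offset-impossible : ∀ {e s q} → e ≡ s + s → e ≤ N → breakOffset e ≡ q → odd q ≡ true → q < N →
    (ps : Vec ℕ (suc s)) → Unique ps →
    All (λ p → p < N × rival e p < e × ((odd p ≡ true × p < q) ⊎ (odd p ≡ false × q ≤ p))) ps → ⊥
  large-offset-impossible e≡2s e≤N refl odd-q q<N ps ps-unique witnesses =
    <-irrefl refl (odd-rivals-bound e≡2s e≤N ps ps-unique (All.map proj₁ witnesses)
                    (All.map (proj₁ ∘ proj₂) witnesses)
                    (All.map (λ (p<N , _ , side) → out-of-phase odd-q q<N p<N side) witnesses))

  breakOffset<2 : ∀ {e} → e ≤ N → (∀ {q} → breakOffset e ≡ q → odd q ≡ true → 1 < q → q < N → ⊥) →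
    breakOffset e < 2
  breakOffset<2 {e} e≤N no-large with canonical e≤N
  ... | inj₁ q≡0 = subst (_< 2) (sym q≡0) (s≤s z≤n)
  ... | inj₂ odd-q with breakOffset e ≤? 1
  ...   | yes q≤1 = s≤s q≤1
  ...   | no  q≰1 = contradiction (breakOffset-< e≤N) (no-large refl odd-q (≰⇒> q≰1))

  -- Eⱼ lists the rounds at distance 1, 3, …, 2j-1 after or before the origin, and Lⱼ the teams
  -- 0, 2, …, 2j-2 and N, N-2, …, N-2j+2; each team of Lⱼ₊₁ meets an in-phase rival in every
  -- round outside Eⱼ.
  E₁ : Vec ℕ 2
  E₁ = 1 ∷ 10 + m ∷ []
  E₂ : Vec ℕ 4
  E₂ = 3 ∷ 8 + m ∷ E₁
  E₃ : Vec ℕ 6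
  E₃ = 5 ∷ 6 + m ∷ E₂

  L₁ : Vec ℕ 2
  L₁ = 0 ∷ N ∷ []
  L₂ : Vec ℕ 4
  L₂ = 2 ∷ 9 + m ∷ L₁
  L₃ : Vec ℕ 6
  L₃ = 4 ∷ 7 + m ∷ L₂

  1<N : 1 < N
  1<N = s≤s (s≤s z≤n)
  3<N : 3 < N
  3<N = s≤s (m≤m+n 3 (7 + m))
  5<N : 5 < N
  5<N = s≤s (m≤m+n 5 (5 + m))
  6+m<N : 6 + m < N
  6+m<N = s≤s (m≤n+m (6 + m) 4)
  8+m<N : 8 + m < N
  8+m<N = s≤s (m≤n+m (8 + m) 2)
  10+m<N : 10 + m < N
  10+m<N = ≤-refl

  2≤N : 2 ≤ N
  2≤N = m≤m+n 2 (9 + m)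
  9+m≤N : 9 + m ≤ N
  9+m≤N = m≤n+m (9 + m) 2

  4≤N : 4 ≤ N
  4≤N = m≤m+n 4 (7 + m)
  7+m≤N : 7 + m ≤ N
  7+m≤N = m≤n+m (7 + m) 4

  6≤N : 6 ≤ N
  6≤N = m≤m+n 6 (5 + m)

  E₁-unique : Unique E₁
  E₁-unique = ((λ ()) ∷ []) ∷ [] ∷ []
  E₂-unique : Unique E₂
  E₂-unique = ((λ ()) ∷ (λ ()) ∷ (λ ()) ∷ []) ∷ ((λ ()) ∷ (λ ()) ∷ []) ∷ E₁-unique

  L₁-unique : Unique L₁
  L₁-unique = ((λ ()) ∷ []) ∷ [] ∷ []
  L₂-unique : Unique L₂
  L₂-unique = ((λ ()) ∷ (λ ()) ∷ (λ ()) ∷ []) ∷ ((λ ()) ∷ (λ ()) ∷ []) ∷ L₁-unique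
  L₃-unique : Unique L₃
  L₃-unique = ((λ ()) ∷ (λ ()) ∷ (λ ()) ∷ (λ ()) ∷ (λ ()) ∷ []) ∷ ((λ ()) ∷ (λ ()) ∷ (λ ()) ∷ (λ ()) ∷ []) ∷ L₂-unique

  E₁<N : All (_< N) E₁
  E₁<N = 1<N ∷ 10+m<N ∷ []
  E₂<N : All (_< N) E₂
  E₂<N = 3<N ∷ 8+m<N ∷ E₁<N

  L₁≤N : All (_≤ N) L₁
  L₁≤N = z≤n ∷ ≤-refl ∷ []
  L₂≤N : All (_≤ N) L₂
  L₂≤N = 2≤N ∷ 9+m≤N ∷ L₁≤N
  L₃≤N : All (_≤ N) L₃
  L₃≤N = 4≤N ∷ 7+m≤N ∷ L₂≤N

  rivals-inPhase₁ : ∀ {p} → p < N → All (RivalInPhase p) L₁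
  rivals-inPhase₁ p<N = exhausted-below⇒rival-inPhase z≤n refl [] [] [] [] p<N []
                     ∷ exhausted-above⇒rival-inPhase ≤-refl odd-N [] refl [] [] [] p<N []
                     ∷ []

  rivals-out-of-phase₁ : ∀ {x} → x ≤ N → All (x ≢_) L₁ → All (OutOfPhaseRival x) E₁
  rivals-out-of-phase₁ x≤N x∉ = at (inj₁ refl) 1<N ∷ at (inj₂ refl) 10+m<N ∷ []
    where
    at : ∀ {p} → AtDistance 0 p → p < N → OutOfPhaseRival _ p
    at level p<N = p<N , outsider-out-of-phase 0 level p<N L₁ L₁-unique L₁≤N (rivals-inPhase₁ p<N) x≤N x∉

  rivals-below-2 : All (λ p → rival 2 p < 2) E₁
  rivals-below-2 = plays-down-in 2≤N refl (rivals-out-of-phase₁ 2≤N ((λ ()) ∷ (λ ()) ∷ []))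

  rivals-above-9+m : All (λ p → 9 + m < rival (9 + m) p) E₁
  rivals-above-9+m = plays-up-in 9+m≤N odd-N (rivals-out-of-phase₁ 9+m≤N ((λ ()) ∷ (λ ()) ∷ []))

  rivals-inPhase₂ : ∀ {p} → p < N → All (p ≢_) E₁ → All (RivalInPhase p) L₂
  rivals-inPhase₂ p<N p∉ = exhausted-below⇒rival-inPhase 2≤N refl E₁ E₁-unique E₁<N rivals-below-2 p<N p∉
                         ∷ exhausted-above⇒rival-inPhase 9+m≤N odd-N E₁ refl E₁-unique E₁<N rivals-above-9+m p<N p∉
                         ∷ rivals-inPhase₁ p<N

  rivals-out-of-phase₂ : ∀ {x} → x ≤ N → All (x ≢_) L₂ → All (OutOfPhaseRival x) E₂
  rivals-out-of-phase₂ x≤N x∉ =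
      at (inj₁ refl) 3<N ((λ ()) ∷ (λ ()) ∷ [])
    ∷ at (inj₂ refl) 8+m<N ((λ ()) ∷ (λ ()) ∷ [])
    ∷ rivals-out-of-phase₁ x≤N (All.tail (All.tail x∉))
    where
    at : ∀ {p} → AtDistance 1 p → p < N → All (p ≢_) E₁ → OutOfPhaseRival _ p
    at level p<N p∉ = p<N , outsider-out-of-phase 1 level p<N L₂ L₂-unique L₂≤N (rivals-inPhase₂ p<N p∉) x≤N x∉

  rivals-below-4 : All (λ p → rival 4 p < 4) E₂
  rivals-below-4 = plays-down-in 4≤N refl (rivals-out-of-phase₂ 4≤N ((λ ()) ∷ (λ ()) ∷ (λ ()) ∷ (λ ()) ∷ []))

  rivals-above-7+m : All (λ p → 7 + m < rival (7 + m) p) E₂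
  rivals-above-7+m = plays-up-in 7+m≤N odd-N (rivals-out-of-phase₂ 7+m≤N ((λ ()) ∷ (λ ()) ∷ (λ ()) ∷ (λ ()) ∷ []))

  rivals-inPhase₃ : ∀ {p} → p < N → All (p ≢_) E₂ → All (RivalInPhase p) L₃
  rivals-inPhase₃ p<N p∉ = exhausted-below⇒rival-inPhase 4≤N refl E₂ E₂-unique E₂<N rivals-below-4 p<N p∉
                         ∷ exhausted-above⇒rival-inPhase 7+m≤N odd-N E₂ refl E₂-unique E₂<N rivals-above-7+m p<N p∉
                         ∷ rivals-inPhase₂ p<N (All.tail (All.tail p∉))

  rivals-out-of-phase₃ : ∀ {x} → x ≤ N → All (x ≢_) L₃ → All (OutOfPhaseRival x) E₃
  rivals-out-of-phase₃ x≤N x∉ =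
      at (inj₁ refl) 5<N ((λ ()) ∷ (λ ()) ∷ (λ ()) ∷ (λ ()) ∷ [])
    ∷ at (inj₂ refl) 6+m<N ((λ ()) ∷ (λ ()) ∷ (λ ()) ∷ (λ ()) ∷ [])
    ∷ rivals-out-of-phase₂ x≤N (All.tail (All.tail x∉))
    where
    at : ∀ {p} → AtDistance 2 p → p < N → All (p ≢_) E₂ → OutOfPhaseRival _ p
    at level p<N p∉ = p<N , outsider-out-of-phase 2 level p<N L₃ L₃-unique L₃≤N (rivals-inPhase₃ p<N p∉) x≤N x∉

  rivals-below-6 : All (λ p → rival 6 p < 6) E₃
  rivals-below-6 = plays-down-in 6≤N refl (rivals-out-of-phase₃ 6≤N ((λ ()) ∷ (λ ()) ∷ (λ ()) ∷ (λ ()) ∷ (λ ()) ∷ (λ ()) ∷ []))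

  breakOffset-of-2 : breakOffset 2 < 2
  breakOffset-of-2 = breakOffset<2 2≤N (large rivals-below-2)
    where
    large : All (λ p → rival 2 p < 2) E₁ → ∀ {q} → breakOffset 2 ≡ q → odd q ≡ true → 1 < q → q < N → ⊥
    large (r₁ ∷ r₁₀ ∷ []) q≡ odd-q 1<q q<N = large-offset-impossible {s = 1} refl 2≤N q≡ odd-q q<N E₁ E₁-unique
          ((1<N , r₁ , inj₁ (refl , 1<q)) ∷ (10+m<N , r₁₀ , inj₂ (m-even , ≤-pred q<N)) ∷ [])

  breakOffset-of-4 : breakOffset 4 < 2
  breakOffset-of-4 = breakOffset<2 4≤N (large rivals-below-4)
    where
    large : All (λ p → rival 4 p < 4) E₂ → ∀ {q} → breakOffset 4 ≡ q → odd q ≡ true → 1 < q → q < N → ⊥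
    large (r₃ ∷ r₈ ∷ r₁ ∷ r₁₀ ∷ []) {q} q≡ odd-q 1<q q<N with q ≤? 3
    ... | yes q≤3 =
      large-offset-impossible {s = 2} refl 4≤N q≡ odd-q q<N (8 + m ∷ 1 ∷ 10 + m ∷ [])
        (((λ ()) ∷ (λ ()) ∷ []) ∷ ((λ ()) ∷ []) ∷ [] ∷ [])
        ( (8+m<N , r₈ , inj₂ (m-even , ≤-trans q≤3 (m≤m+n 3 (5 + m))))
        ∷ (1<N , r₁ , inj₁ (refl , 1<q))
        ∷ (10+m<N , r₁₀ , inj₂ (m-even , ≤-pred q<N)) ∷ [])
    ... | no q≰3 =
      large-offset-impossible {s = 2} refl 4≤N q≡ odd-q q<N (3 ∷ 1 ∷ 10 + m ∷ [])
        (((λ ()) ∷ (λ ()) ∷ []) ∷ ((λ ()) ∷ []) ∷ [] ∷ [])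
        ( (3<N , r₃ , inj₁ (refl , ≰⇒> q≰3))
        ∷ (1<N , r₁ , inj₁ (refl , 1<q))
        ∷ (10+m<N , r₁₀ , inj₂ (m-even , ≤-pred q<N)) ∷ [])

  breakOffset-of-6 : breakOffset 6 < 2
  breakOffset-of-6 = breakOffset<2 6≤N (large rivals-below-6)
    where
    large : All (λ p → rival 6 p < 6) E₃ → ∀ {q} → breakOffset 6 ≡ q → odd q ≡ true → 1 < q → q < N → ⊥
    large (r₅ ∷ r₆ ∷ r₃ ∷ r₈ ∷ r₁ ∷ r₁₀ ∷ []) {q} q≡ odd-q 1<q q<N with q ≤? 5
    ... | yes q≤5 =
      large-offset-impossible {s = 3} refl 6≤N q≡ odd-q q<N (6 + m ∷ 8 + m ∷ 1 ∷ 10 + m ∷ [])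
        (((λ ()) ∷ (λ ()) ∷ (λ ()) ∷ []) ∷ ((λ ()) ∷ (λ ()) ∷ []) ∷ ((λ ()) ∷ []) ∷ [] ∷ [])
        ( (6+m<N , r₆ , inj₂ (m-even , ≤-trans q≤5 (m≤m+n 5 (1 + m))))
        ∷ (8+m<N , r₈ , inj₂ (m-even , ≤-trans q≤5 (m≤m+n 5 (3 + m))))
        ∷ (1<N , r₁ , inj₁ (refl , 1<q))
        ∷ (10+m<N , r₁₀ , inj₂ (m-even , ≤-pred q<N)) ∷ [])
    ... | no q≰5 =
      large-offset-impossible {s = 3} refl 6≤N q≡ odd-q q<N (5 ∷ 3 ∷ 1 ∷ 10 + m ∷ [])
        (((λ ()) ∷ (λ ()) ∷ (λ ()) ∷ []) ∷ ((λ ()) ∷ (λ ()) ∷ []) ∷ ((λ ()) ∷ []) ∷ [] ∷ [])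
        ( (5<N , r₅ , inj₁ (refl , ≰⇒> q≰5))
        ∷ (3<N , r₃ , inj₁ (refl , ≤-trans (m≤m+n 4 2) (≰⇒> q≰5)))
        ∷ (1<N , r₁ , inj₁ (refl , 1<q))
        ∷ (10+m<N , r₁₀ , inj₂ (m-even , ≤-pred q<N)) ∷ [])

  impossible : ⊥
  impossible = <-irrefl refl (same-parity-bound (2 ∷ 4 ∷ 6 ∷ [])
    (((λ ()) ∷ (λ ()) ∷ []) ∷ ((λ ()) ∷ []) ∷ [] ∷ [])
    ((2≤N , refl) ∷ (4≤N , refl) ∷ (6≤N , refl) ∷ [])
    (breakOffset-of-2 ∷ breakOffset-of-4 ∷ breakOffset-of-6 ∷ []))

-- From schedules to tournaments

toℕ-punchOut-< : ∀ {n} {i j : Fin (suc n)} (i≢j : i ≢ j) → toℕ j < toℕ i → toℕ (punchOut i≢j) ≡ toℕ j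
toℕ-punchOut-< {_}     {zero}  {_}     _   ()
toℕ-punchOut-< {suc n} {suc i} {zero}  _   _         = refl
toℕ-punchOut-< {suc n} {suc i} {suc j} i≢j (s≤s j<i) = cong suc (toℕ-punchOut-< (i≢j ∘ cong suc) j<i)

toℕ-punchOut-> : ∀ {n} {i j : Fin (suc n)} (i≢j : i ≢ j) → toℕ i < toℕ j → suc (toℕ (punchOut i≢j)) ≡ toℕ j
toℕ-punchOut-> {_}     {zero}  {zero}  _   ()
toℕ-punchOut-> {_}     {zero}  {suc j} _   _         = refl
toℕ-punchOut-> {suc n} {suc i} {zero}  _   ()
toℕ-punchOut-> {suc n} {suc i} {suc j} i≢j (s≤s i<j) = cong suc (toℕ-punchOut-> (i≢j ∘ cong suc) i<j)

module FromSchedule {N′ : ℕ} (S : Schedule (suc N′)) (feasible : Feasible S) (single : SingleBreak S)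
                    (fair : RankingFair S) (odd-N : odd (suc N′) ≡ true) (origin : Fin (suc N′)) where
  open Schedule S
  open Cyclic (suc N′)

  private
    N : ℕ
    N = suc N′
    Team = Fin (suc N)
    Round = Fin N

  opp : Team → Round → Team
  opp i t = proj₁ (feasible i t)

  opp≢ : ∀ i t → opp i t ≢ i
  opp≢ i t = proj₁ (proj₁ (proj₂ (feasible i t)))

  rnd-opp : ∀ i t → rnd i (opp i t) ≡ t
  rnd-opp i t = proj₂ (proj₁ (proj₂ (feasible i t)))

  opp-unique : ∀ {i t j} → j ≢ i → rnd i j ≡ t → j ≡ opp i t
  opp-unique {i} {t} {j} = proj₂ (proj₂ (feasible i t)) j

  opp-involutive : ∀ i t → opp (opp i t) t ≡ i
  opp-involutive i t = sym (opp-unique (opp≢ i t ∘ sym) (trans (rnd-sym (opp i t) i) (rnd-opp i t)))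

  opp-injectiveʳ : ∀ {i t t′} → opp i t ≡ opp i t′ → t ≡ t′
  opp-injectiveʳ {i} {t} {t′} eq = trans (sym (rnd-opp i t)) (trans (cong (rnd i) eq) (rnd-opp i t′))

  venue : Team → Round → Bool
  venue i t = home i (opp i t)

  base : Team → Bool
  base i = rankingHAP S i zero

  home-by-rank : ∀ i (k : Round) → home i (punchIn i k) ≡ base i xor odd (toℕ k)
  home-by-rank i k = walk (toℕ k) k refl
    where
    walk : ∀ n (k : Round) → toℕ k ≡ n → home i (punchIn i k) ≡ base i xor odd n
    walk zero    zero    _  = sym (xor-identityʳ (base i))
    walk zero    (suc k) ()
    walk (suc n) zero    ()
    walk (suc n) (suc k) eq = begin
      home i (punchIn i (suc k))              ≡⟨ ¬-not (fair i (inject₁ k) (suc k) (cong suc (sym (toℕ-inject₁ k))) ∘ sym) ⟩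
      not (home i (punchIn i (inject₁ k)))    ≡⟨ cong not (walk n (inject₁ k) (trans (toℕ-inject₁ k) (suc-injective eq))) ⟩
      not (base i xor odd n)                  ≡⟨ not-distribʳ-xor (base i) (odd n) ⟩
      base i xor not (odd n)                  ≡⟨ cong (base i xor_) (odd-suc n) ⟨
      base i xor odd (suc n)                  ∎
      where open ≡-Reasoning

  home-by-opponent : ∀ {i j} (i≢j : i ≢ j) → home i j ≡ base i xor odd (toℕ (punchOut i≢j))
  home-by-opponent {i} i≢j = trans (cong (home i) (sym (punchIn-punchOut i≢j))) (home-by-rank i _)

  breakRound : Team → Round
  breakRound i = proj₁ (single i)

  venue-alternates : ∀ i t → t ≢ breakRound i → venue i (prev t) ≢ venue i t
  venue-alternates i t t≢β same = t≢β (proj₂ (proj₂ (single i)) t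
    (venue i t , (opp i (prev t) , opp≢ i (prev t) , rnd-opp i (prev t) , same)
               , (opp i t , opp≢ i t , rnd-opp i t , refl)))

  round : ℕ → Round
  round y = (toℕ origin + y) mod N

  toℕ-round : ∀ y → toℕ (round y) ≡ (toℕ origin + y) % N
  toℕ-round y = toℕ-fromℕ< _

  offset : Round → ℕ
  offset t = dist (toℕ origin) (toℕ t)

  breakOffset : Team → ℕ
  breakOffset i = offset (breakRound i)

  private
    origin≤N : toℕ origin ≤ N
    origin≤N = <⇒≤ (toℕ<n origin)

  round-offset : ∀ t → round (offset t) ≡ t
  round-offset t = toℕ-injective
    (trans (toℕ-round (offset t)) (trans (+-dist (toℕ t) origin≤N) (m<n⇒m%n≡m (toℕ<n t))))

  offset-round : ∀ y → offset (round y) ≡ y % N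
  offset-round y = trans (cong (dist (toℕ origin)) (toℕ-round y)) (trans (dist-%ʳ _ _) (dist-+ y origin≤N))

  offset-injective : ∀ {t t′} → offset t ≡ offset t′ → t ≡ t′
  offset-injective {t} {t′} eq = trans (sym (round-offset t)) (trans (cong round eq) (round-offset t′))

  round-cong : ∀ {x y} → x % N ≡ y % N → round x ≡ round y
  round-cong {x} {y} eq = offset-injective (trans (offset-round x) (trans eq (sym (offset-round y))))

  toℕ-prev : ∀ (t : Round) → toℕ (prev t) ≡ (toℕ t + N′) % N
  toℕ-prev zero    = trans (toℕ-fromℕ N′) (sym (m<n⇒m%n≡m ≤-refl))
  toℕ-prev (suc r) = begin
    toℕ (inject₁ r)             ≡⟨ toℕ-inject₁ r ⟩
    toℕ r                       ≡⟨ m<n⇒m%n≡m (m<n⇒m<1+n (toℕ<n r)) ⟨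
    toℕ r % N                   ≡⟨ [m+n]%n≡m%n (toℕ r) N ⟨
    (toℕ r + N) % N             ≡⟨ cong (_% N) (+-suc (toℕ r) N′) ⟩
    (suc (toℕ r) + N′) % N      ∎
    where open ≡-Reasoning

  prev-round : ∀ y → prev (round (suc y)) ≡ round y
  prev-round y = toℕ-injective (begin
    toℕ (prev (round (suc y)))               ≡⟨ toℕ-prev (round (suc y)) ⟩
    (toℕ (round (suc y)) + N′) % N           ≡⟨ cong (λ r → (r + N′) % N) (toℕ-round (suc y)) ⟩
    ((toℕ origin + suc y) % N + N′) % N      ≡⟨ %-absorbˡ (toℕ origin + suc y) N′ ⟩
    (toℕ origin + suc y + N′) % N            ≡⟨ cong (λ r → (r + N′) % N) (+-suc (toℕ origin) y) ⟩
    (suc (toℕ origin + y) + N′) % N          ≡⟨ cong (_% N) (+-suc (toℕ origin + y) N′) ⟨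
    (toℕ origin + y + N) % N                 ≡⟨ [m+n]%n≡m%n (toℕ origin + y) N ⟩
    (toℕ origin + y) % N                     ≡⟨ toℕ-round y ⟨
    toℕ (round y)                            ∎)
    where open ≡-Reasoning

  venue-from-break : ∀ i p → venue i (round p) ≡ venue i (breakRound i) xor odd (dist (breakOffset i) p)
  venue-from-break i p = begin
    venue i (round p)                                       ≡⟨ walk p ⟩
    venue i (round (breakOffset i)) xor odd (dist (breakOffset i) p)
      ≡⟨ cong (λ t → venue i t xor odd (dist (breakOffset i) p)) (round-offset (breakRound i)) ⟩
    venue i (breakRound i) xor odd (dist (breakOffset i) p) ∎
    where
    open ≡-Reasoning
    q<N : breakOffset i < N
    q<N = dist-< _ _
    alternates : ∀ y → suc y % N ≢ breakOffset i % N → venue i (round (suc y)) ≢ venue i (round y)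
    alternates y off eq = venue-alternates i (round (suc y))
      (λ at-break → off (trans (sym (offset-round (suc y))) (trans (cong offset at-break) (sym (m<n⇒m%n≡m q<N)))))
      (trans (cong (venue i) (prev-round y)) (sym eq))
    walk = alternating-walk (λ y → venue i (round y)) q<N (cong (venue i) ∘ round-cong) alternates

  -- Otherwise the distance from the break to the game against the k-th strongest opponent would
  -- have parity opposite to k for every k < N, which is impossible as N is odd.
  venue-at-break : ∀ i → venue i (breakRound i) ≡ base i
  venue-at-break i with venue i (breakRound i) Bool.≟ base i
  ... | yes same   = same
  ... | no  differ = ⊥-elim (no-parity-reversing-injection odd-N gap (λ _ → dist-< _ _) flips gap-inj)
    where
    meeting : Round → Round
    meeting k = rnd i (punchIn i k)
    gap : Round → ℕ
    gap k = dist (breakOffset i) (offset (meeting k))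
    opp-meeting : ∀ k → opp i (meeting k) ≡ punchIn i k
    opp-meeting k = sym (opp-unique (punchInᵢ≢i i k) refl)
    flips : ∀ k → odd (gap k) ≡ not (odd (toℕ k))
    flips k = xor-flip (base i) (odd (toℕ k)) (odd (gap k)) (begin
      base i xor odd (toℕ k)                   ≡⟨ home-by-rank i k ⟨
      home i (punchIn i k)                     ≡⟨ cong (home i) (opp-meeting k) ⟨
      venue i (meeting k)                      ≡⟨ cong (venue i) (round-offset (meeting k)) ⟨
      venue i (round (offset (meeting k)))     ≡⟨ venue-from-break i _ ⟩
      venue i (breakRound i) xor odd (gap k)   ≡⟨ cong (_xor odd (gap k)) (¬-not differ) ⟩
      not (base i) xor odd (gap k)             ∎)
      where open ≡-Reasoning
    gap-inj : ∀ {k k′} → gap k ≡ gap k′ → k ≡ k′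
    gap-inj {k} {k′} eq = punchIn-injective i k k′ (begin
      punchIn i k             ≡⟨ opp-meeting k ⟨
      opp i (meeting k)       ≡⟨ cong (opp i) same-round ⟩
      opp i (meeting k′)      ≡⟨ opp-meeting k′ ⟩
      punchIn i k′            ∎)
      where
      open ≡-Reasoning
      same-round : meeting k ≡ meeting k′
      same-round = offset-injective (dist-injectiveʳ {breakOffset i} (<⇒≤ (dist-< _ _)) (dist-< _ _) (dist-< _ _) eq)

  rank-parity : ∀ i p → odd (dist (breakOffset i) p) ≡ odd (toℕ (punchOut (opp≢ i (round p) ∘ sym)))
  rank-parity i p = xor-cancelˡ (base i) (begin
    base i xor odd (dist (breakOffset i) p)                 ≡⟨ cong (_xor odd (dist (breakOffset i) p)) (venue-at-break i) ⟨
    venue i (breakRound i) xor odd (dist (breakOffset i) p) ≡⟨ venue-from-break i p ⟨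
    venue i (round p)                                       ≡⟨ home-by-opponent i≢j ⟩
    base i xor odd (toℕ (punchOut i≢j))                     ∎)
    where
    open ≡-Reasoning
    i≢j = opp≢ i (round p) ∘ sym

  team : ℕ → Team
  team v = v mod suc N

  toℕ-team : ∀ {v} → v ≤ N → toℕ (team v) ≡ v
  toℕ-team v≤N = trans (toℕ-fromℕ< _) (m<n⇒m%n≡m (s≤s v≤N))

  team-toℕ : ∀ i → team (toℕ i) ≡ i
  team-toℕ i = toℕ-injective (toℕ-team (≤-pred (toℕ<n i)))

  rival : ℕ → ℕ → ℕ
  rival v p = toℕ (opp (team v) (round p))

  tournament : Tournament N
  tournament = record
    { rival            = rival
    ; breakOffset      = breakOffset ∘ team
    ; rival-≤          = λ _ _ → ≤-pred (toℕ<n _)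
    ; rival-≢          = λ v≤N _ eq → opp≢ _ _ (toℕ-injective (trans eq (sym (toℕ-team v≤N))))
    ; rival-involutive = involutive
    ; rival-injectiveʳ = injectiveʳ
    ; rival-meets      = meets
    ; breakOffset-<    = λ _ → dist-< _ _
    ; inPhase-up       = up
    ; inPhase-down     = down
    }
    where
    involutive : ∀ {v p} → v ≤ N → p < N → rival (rival v p) p ≡ v
    involutive {v} {p} v≤N _ = begin
      toℕ (opp (team (toℕ (opp (team v) (round p)))) (round p))   ≡⟨ cong (λ i → toℕ (opp i (round p))) (team-toℕ _) ⟩
      toℕ (opp (opp (team v) (round p)) (round p))                 ≡⟨ cong toℕ (opp-involutive (team v) (round p)) ⟩
      toℕ (team v)                                                 ≡⟨ toℕ-team v≤N ⟩
      v                                                            ∎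
      where open ≡-Reasoning
    injectiveʳ : ∀ {v p p′} → v ≤ N → p < N → p′ < N → rival v p ≡ rival v p′ → p ≡ p′
    injectiveʳ {p = p} {p′} _ p<N p′<N eq = begin
      p                      ≡⟨ m<n⇒m%n≡m p<N ⟨
      p % N                  ≡⟨ offset-round p ⟨
      offset (round p)       ≡⟨ cong offset (opp-injectiveʳ (toℕ-injective eq)) ⟩
      offset (round p′)      ≡⟨ offset-round p′ ⟩
      p′ % N                 ≡⟨ m<n⇒m%n≡m p′<N ⟩
      p′                     ∎
      where open ≡-Reasoning
    meets : ∀ {v w} → v ≤ N → w ≤ N → v ≢ w → ∃ λ p → p < N × rival v p ≡ w
    meets {v} {w} v≤N w≤N v≢w = offset t , dist-< _ _ , (begin
      toℕ (opp (team v) (round (offset t)))    ≡⟨ cong (toℕ ∘ opp (team v)) (round-offset t) ⟩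
      toℕ (opp (team v) t)                     ≡⟨ cong toℕ (opp-unique w≢v refl) ⟨
      toℕ (team w)                             ≡⟨ toℕ-team w≤N ⟩
      w                                        ∎)
      where
      open ≡-Reasoning
      t = rnd (team v) (team w)
      w≢v : team w ≢ team v
      w≢v eq = v≢w (trans (sym (toℕ-team v≤N)) (trans (cong toℕ (sym eq)) (toℕ-team w≤N)))
    up : ∀ {v p} → v ≤ N → p < N → v < rival v p → evenGap (breakOffset (team v)) p ≡ odd (rival v p)
    up {v} {p} v≤N _ v<w = begin
      evenGap (breakOffset (team v)) p   ≡⟨ cong not (rank-parity (team v) p) ⟩
      not (odd (toℕ (punchOut i≢j)))     ≡⟨ odd-suc (toℕ (punchOut i≢j)) ⟨
      odd (suc (toℕ (punchOut i≢j)))     ≡⟨ cong odd (toℕ-punchOut-> i≢j (subst (_< rival v p) (sym (toℕ-team v≤N)) v<w)) ⟩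
      odd (rival v p)                    ∎
      where
      open ≡-Reasoning
      i≢j = opp≢ (team v) (round p) ∘ sym
    down : ∀ {v p} → v ≤ N → p < N → rival v p < v → evenGap (breakOffset (team v)) p ≡ not (odd (rival v p))
    down {v} {p} v≤N _ w<v = trans (cong not (rank-parity (team v) p))
      (cong (not ∘ odd) (toℕ-punchOut-< i≢j (subst (rival v p <_) (sym (toℕ-team v≤N)) w<v)))
      where
      i≢j = opp≢ (team v) (round p) ∘ sym

-- The canonical D-sequence

module CanonicalGaps {N′ k : ℕ} (rs : Fin k → Fin (suc N′))
  (increasing : ∀ a b → toℕ a < toℕ b → toℕ (rs a) < toℕ (rs b))
  (d : Fin k → ℕ) (gaps : ∀ a b → toℕ b ≡ suc (toℕ a) → d a ≡ toℕ (rs b) ∸ toℕ (rs a))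
  (a₀ : Fin k) (short : d a₀ ≡ 1) (long : ∀ a → a ≢ a₀ → d a ≡ 2) where

  open Cyclic (suc N′)

  private
    x : Fin k → ℕ
    x a = toℕ (rs a)

  step : ∀ {a b} → toℕ b ≡ suc (toℕ a) → x b ≡ x a + d a
  step {a} {b} b≡ = trans (sym (m+[n∸m]≡n (<⇒≤ (increasing a b (≤-reflexive (sym b≡))))))
                          (cong (x a +_) (sym (gaps a b b≡)))

  climb : ∀ j {b} → toℕ b ≡ toℕ a₀ + suc j → x b ≡ x a₀ + suc (j + j)
  climb zero    b≡ = trans (step (trans b≡ (+-comm (toℕ a₀) 1))) (cong (x a₀ +_) short)
  climb (suc j) {b} b≡ = begin
    x b                          ≡⟨ step (trans b≡ (trans (+-suc (toℕ a₀) (suc j)) (cong suc (sym (toℕ-fromℕ< b′<k))))) ⟩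
    x b′ + d b′                  ≡⟨ cong (x b′ +_) (long b′ b′≢a₀) ⟩
    x b′ + 2                     ≡⟨ cong (_+ 2) (climb j (toℕ-fromℕ< b′<k)) ⟩
    x a₀ + suc (j + j) + 2       ≡⟨ two-more (x a₀) j ⟩
    x a₀ + suc (suc j + suc j)   ∎
    where
    open ≡-Reasoning
    two-more : ∀ a j → a + suc (j + j) + 2 ≡ a + suc (suc j + suc j)
    two-more = solve-∀
    b′<k : toℕ a₀ + suc j < k
    b′<k = subst (_≤ k) (trans b≡ (+-suc (toℕ a₀) (suc j))) (<⇒≤ (toℕ<n b))
    b′ : Fin k
    b′ = fromℕ< b′<k
    b′≢a₀ : b′ ≢ a₀
    b′≢a₀ eq = m+1+n≢m (toℕ a₀) (trans (sym (toℕ-fromℕ< b′<k)) (cong toℕ eq))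

  descend : ∀ j {b} → toℕ b + suc j ≡ toℕ a₀ → x b + (suc j + suc j) ≡ x a₀
  descend zero    {b} b≡ = sym (trans (step (trans (sym b≡) (+-comm (toℕ b) 1))) (cong (x b +_) (long b b≢a₀)))
    where
    b≢a₀ : b ≢ a₀
    b≢a₀ refl = m+1+n≢m (toℕ b) b≡
  descend (suc j) {b} b≡ = begin
    x b + (suc (suc j) + suc (suc j))   ≡⟨ two-more (x b) j ⟩
    x b + 2 + (suc j + suc j)           ≡⟨ cong (_+ (suc j + suc j)) (cong (x b +_) (long b b≢a₀)) ⟨
    x b + d b + (suc j + suc j)         ≡⟨ cong (_+ (suc j + suc j)) (step (toℕ-fromℕ< b′<k)) ⟨
    x b′ + (suc j + suc j)              ≡⟨ descend j b′≡ ⟩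
    x a₀                                ∎
    where
    open ≡-Reasoning
    two-more : ∀ a j → a + (suc (suc j) + suc (suc j)) ≡ a + 2 + (suc j + suc j)
    two-more = solve-∀
    b′<k : suc (toℕ b) < k
    b′<k = <-trans (subst (suc (toℕ b) <_) (trans (sym (+-suc (toℕ b) (suc j))) b≡) (s≤s (m<m+n (toℕ b) z<s))) (toℕ<n a₀)
    b′ : Fin k
    b′ = fromℕ< b′<k
    b′≡ : toℕ b′ + suc j ≡ toℕ a₀
    b′≡ = trans (cong (_+ suc j) (toℕ-fromℕ< b′<k)) (trans (sym (+-suc (toℕ b) (suc j))) b≡)
    b≢a₀ : b ≢ a₀
    b≢a₀ refl = m+1+n≢m (toℕ b) b≡

  canonical-offset : odd (suc N′) ≡ true → ∀ b → dist (x a₀) (x b) ≡ 0 ⊎ odd (dist (x a₀) (x b)) ≡ true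
  canonical-offset odd-N b with <-cmp (toℕ b) (toℕ a₀)
  ... | tri≈ _ b≡a₀ _ = inj₁ (begin
    dist (x a₀) (x b)      ≡⟨ cong (λ c → dist (x a₀) (x c)) (toℕ-injective b≡a₀) ⟩
    dist (x a₀) (x a₀)     ≡⟨ dist-≤ ≤-refl (toℕ<n (rs a₀)) ⟩
    x a₀ ∸ x a₀            ≡⟨ n∸n≡0 (x a₀) ⟩
    0                      ∎)
    where open ≡-Reasoning
  ... | tri> _ _ a₀<b = inj₂ (begin
    odd (dist (x a₀) (x b))            ≡⟨ cong odd (dist-≤ (<⇒≤ (increasing a₀ b a₀<b)) (toℕ<n (rs b))) ⟩
    odd (x b ∸ x a₀)                   ≡⟨ cong (λ y → odd (y ∸ x a₀)) (climb j b≡) ⟩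
    odd (x a₀ + suc (j + j) ∸ x a₀)    ≡⟨ cong odd (m+n∸m≡n (x a₀) _) ⟩
    odd (suc (j + j))                  ≡⟨ odd-suc-double j ⟩
    true                               ∎)
    where
    open ≡-Reasoning
    j = toℕ b ∸ suc (toℕ a₀)
    b≡ : toℕ b ≡ toℕ a₀ + suc j
    b≡ = trans (sym (m+[n∸m]≡n a₀<b)) (sym (+-suc (toℕ a₀) j))
  ... | tri< b<a₀ _ _ = inj₂ (begin
    odd (dist (x a₀) (x b))            ≡⟨ odd-dist-> odd-N (increasing b a₀ b<a₀) (<⇒≤ (toℕ<n (rs a₀))) ⟩
    not (odd (x b) xor odd (x a₀))     ≡⟨ cong (λ y → not (odd (x b) xor odd y)) (descend j b≡) ⟨
    not (odd (x b) xor odd (x b + (suc j + suc j)))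
                                       ≡⟨ cong (λ y → not (odd (x b) xor y)) (odd-+-double (x b) (suc j)) ⟩
    not (odd (x b) xor odd (x b))      ≡⟨ cong not (xor-same (odd (x b))) ⟩
    true                               ∎)
    where
    open ≡-Reasoning
    j = toℕ a₀ ∸ suc (toℕ b)
    b≡ : toℕ b + suc j ≡ toℕ a₀
    b≡ = trans (+-suc (toℕ b) j) (m+[n∸m]≡n b<a₀)
    odd-+-double : ∀ y j → odd (y + (j + j)) ≡ odd y
    odd-+-double y j = trans (odd-+ y (j + j)) (trans (cong (odd y xor_) (odd-double j)) (xor-identityʳ (odd y)))

cyc-< : ∀ {k x} → x < k → cyc k x ≡ x
cyc-< {k} {x} x<k with x <ᵇ k in eq
... | true  = refl
... | false = ⊥-elim (subst T eq (<⇒<ᵇ x<k))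

cyc-≥ : ∀ {k x} → k ≤ x → cyc k x ≡ x ∸ k
cyc-≥ {k} {x} k≤x with x <ᵇ k in eq
... | true  = contradiction (<ᵇ⇒< x k (subst T (sym eq) _)) (≤⇒≯ k≤x)
... | false = refl

canon-last : ∀ k → canon k (k ∸ 1) ≡ 1
canon-last k with (k ∸ 1) ≡ᵇ (k ∸ 1) in eq
... | true  = refl
... | false = ⊥-elim (subst T eq (≡⇒≡ᵇ (k ∸ 1) (k ∸ 1) refl))

canon-other : ∀ {k j} → j ≢ k ∸ 1 → canon k j ≡ 2
canon-other {k} {j} j≢ with j ≡ᵇ (k ∸ 1) in eq
... | true  = contradiction (≡ᵇ⇒≡ j (k ∸ 1) (subst T (sym eq) _)) j≢
... | false = refl

canon-cyc-other : ∀ {k x} → suc x < k + k → x ≢ k ∸ 1 → canon k (cyc k x) ≡ 2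
canon-cyc-other {zero}   ()
canon-cyc-other {suc k′} {x} bound x≢ with x <? suc k′
... | yes x<k = trans (cong (canon (suc k′)) (cyc-< x<k)) (canon-other {suc k′} {x} x≢)
... | no  x≮k = trans (cong (canon (suc k′)) (cyc-≥ k≤x)) (canon-other {suc k′} {x ∸ suc k′} wrapped≢)
  where
  k≤x = ≮⇒≥ x≮k
  wrapped≢ : x ∸ suc k′ ≢ k′
  wrapped≢ eq = <-irrefl (cong suc (trans (sym (m∸n+n≡m k≤x)) (cong (_+ suc k′) eq))) bound

sum-bound : ∀ {k a b} → a < k → b < k → suc (a + b) < k + k
sum-bound {k} {a} {b} a<k b<k = subst (_≤ k + k) (cong suc (+-suc a b)) (+-mono-≤ a<k b<k)

OneShortGap : (k : ℕ) → (Fin k → ℕ) → Set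
OneShortGap k d = ∃ λ a₀ → d a₀ ≡ 1 × (∀ a → a ≢ a₀ → d a ≡ 2)

rotation-shortGap : ∀ {k d} → IsRotationOfCanon k d → OneShortGap k d
rotation-shortGap {zero}   (_ , () , _)
rotation-shortGap {suc k′} {d} (s , s<k , d≡) = a₀ , short , long
  where
  a₀<k : k′ ∸ s < suc k′
  a₀<k = s≤s (m∸n≤m k′ s)
  a₀ = fromℕ< a₀<k
  at-a₀ : toℕ a₀ + s ≡ k′
  at-a₀ = trans (cong (_+ s) (toℕ-fromℕ< a₀<k)) (m∸n+n≡m (≤-pred s<k))
  short : d a₀ ≡ 1
  short = trans (d≡ a₀) (trans (cong (canon (suc k′) ∘ cyc (suc k′)) at-a₀)
                              (trans (cong (canon (suc k′)) (cyc-< {suc k′} {k′} ≤-refl)) (canon-last (suc k′))))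
  long : ∀ a → a ≢ a₀ → d a ≡ 2
  long a a≢a₀ = trans (d≡ a) (canon-cyc-other {suc k′} {toℕ a + s} (sum-bound (toℕ<n a) s<k)
    λ eq → a≢a₀ (toℕ-injective (+-cancelʳ-≡ s _ _ (trans eq (sym at-a₀)))))

reversal-shortGap : ∀ {k d} → IsReversedRotationOfCanon k d → OneShortGap k d
reversal-shortGap {zero}   (_ , () , _)
reversal-shortGap {suc k′} {d} (s , s<k , d≡) = a₀ , short , long
  where
  a₀ = fromℕ< s<k
  at-a₀ : (k′ ∸ toℕ a₀) + s ≡ k′
  at-a₀ = trans (cong (λ t → (k′ ∸ t) + s) (toℕ-fromℕ< s<k)) (m∸n+n≡m (≤-pred s<k))
  short : d a₀ ≡ 1
  short = trans (d≡ a₀) (trans (cong (canon (suc k′) ∘ cyc (suc k′)) at-a₀)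
                              (trans (cong (canon (suc k′)) (cyc-< {suc k′} {k′} ≤-refl)) (canon-last (suc k′))))
  long : ∀ a → a ≢ a₀ → d a ≡ 2
  long a a≢a₀ = trans (d≡ a) (canon-cyc-other {suc k′} {k′ ∸ toℕ a + s} (sum-bound (s≤s (m∸n≤m k′ (toℕ a))) s<k)
    λ eq → a≢a₀ (toℕ-injective (trans
      (∸-cancelˡ-≡ (≤-pred (toℕ<n a)) (≤-pred s<k) (+-cancelʳ-≡ s _ _ (trans eq (sym (m∸n+n≡m (≤-pred s<k))))))
      (sym (toℕ-fromℕ< s<k)))))

canonical-shortGap : ∀ {k d} → IsRotationOfCanon k d ⊎ IsReversedRotationOfCanon k d → OneShortGap k d
canonical-shortGap = [ rotation-shortGap , reversal-shortGap ]

one-short-gap-impossible : ∀ {n k} → (∃ λ m → 12 + m ≡ n) → 2 ∣ n → (S : Schedule (n ∸ 1)) →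
  Feasible S → SingleBreak S → RankingFair S → (d : Fin k → ℕ) → DSequence S k d → OneShortGap k d → ⊥
one-short-gap-impossible (m , refl) 2∣n S feasible single fair d (rs , increasing , breaks , gaps , _) (a₀ , short , long) =
  CanonicalOffsets.impossible m-even tournament canonical
  where
  m-even : odd m ≡ false
  m-even = 2∣⇒odd≡false 2∣n
  odd-N : odd (11 + m) ≡ true
  odd-N = trans (odd-suc m) (cong not m-even)
  open FromSchedule S feasible single fair odd-N (rs a₀)
  canonical : ∀ {v} → v ≤ 11 + m → breakOffset (team v) ≡ 0 ⊎ odd (breakOffset (team v)) ≡ true
  canonical {v} _ with Equivalence.to (breaks (breakRound (team v))) (team v , proj₁ (proj₂ (single (team v))))
  ... | a , rs-a≡ = subst (λ r → offset r ≡ 0 ⊎ odd (offset r) ≡ true) rs-a≡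
                      (CanonicalGaps.canonical-offset rs increasing d gaps a₀ short long odd-N a)

theorem3 : (n : ℕ) → 12 ≤ n → 2 ∣ n →
    (S : Schedule (n ∸ 1)) → Feasible S → SingleBreak S → RankingFair S →
    (d : Fin (n / 2) → ℕ) → DSequence S (n / 2) d →
    ¬ (IsRotationOfCanon (n / 2) d ⊎ IsReversedRotationOfCanon (n / 2) d)
theorem3 n 12≤n 2∣n S feasible single fair d dseq =
  one-short-gap-impossible (m≤n⇒∃[o]m+o≡n 12≤n) 2∣n S feasible single fair d dseq ∘ canonical-shortGap
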